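{- If $\models \{P\}\,W(t,B)\,\{Q\}$ holds and $I$ is a safe invariant for the loop $W(t,B)$ (w.r.t. $P$), then there exists a correct summary $R$ for $W(t,B)$ with respect to $P$ and $Q$.
   Context: States form a set $S$. Commands are relations $C \subseteq S \times \hat S$ with $\hat S = S \uplus \{\mathsf{err}\} \uplus \{\mathrm{brk}(s) \mid s \in S\}$, where $\mathsf{err}$ denotes a runtime error outcome and $\mathrm{brk}(s)$ denotes early exit of a loop via a break command in state $s$. Validity: $\models \{P\}\,C\,\{Q\}$ iff for all $s,\hat s'$, $P(s) \land C(s,\hat s') \implies Q(\hat s')$, where $P,Q \subseteq S$. The loop $W(t,B)$ with test $t\subseteq S$ and body $B\subseteq S\times\hat S$ is the least relation with: $\lnot t(s) \implies W(t,B)(s,s)$; $t(s)\land B(s,\mathsf{err}) \implies W(t,B)(s,\mathsf{err})$; $t(s)\land B(s,\mathrm{brk}(s')) \implies W(t,B)(s,s')$; $t(s)\land B(s,s')\land W(t,B)(s',\hat s'') \implies W(t,B)(s,\hat s'')$. $I\subseteq S$ is an invariant w.r.t. $P$ if $P(s_0)\implies I(s_0)$ and $I(s)\land t(s)\land B(s,s')\implies I(s')$; safe if additionally $I(s)\land t(s)\land B(s,\mathsf{err})\implies\mathit{false}$. $R\subseteq S\times S$ is a summary if $\lnot t(s_n)\implies R(s_n,s_n)$; $t(s)\land B(s,\mathrm{brk}(s_n))\implies R(s,s_n)$; $t(s)\land B(s,s')\land R(s',s_n)\implies R(s,s_n)$; it is correct w.r.t. $P,Q$ if also $P(s_0)\land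 R(s_0,s_n)\implies Q(s_n)$. -}

module Defs where

open import Data.Empty using (⊥)
open import Data.Product using (_×_)

data Ŝ (S : Set) : Set where
  ok  : S → Ŝ S
  err : Ŝ S
  brk : S → Ŝ S

Pred : Set → Set₁
Pred S = S → Set

Cmd : Set → Set₁
Cmd S = S → Ŝ S → Set

-- Validity  ⊨ {P} C {Q}: postcondition Q ⊆ S is applied to outcomes in Ŝ;
-- an outcome that is not a normal state (err, brk) never satisfies Q.
LiftPred : {S : Set} → Pred S → Ŝ S → Set
LiftPred Q (ok s)  = Q s
LiftPred Q err     = ⊥
LiftPred Q (brk s) = ⊥

Valid : {S : Set} → Pred S → Cmd S → Pred S → Set
Valid P C Q = ∀ s ŝ' → P s → C s ŝ' → LiftPred Q ŝ'

data W {S : Set} (t : Pred S) (B : Cmd S) : Cmd S where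
  w-exit : ∀ {s} → (t s → ⊥) → W t B s (ok s)
  w-err  : ∀ {s} → t s → B s err → W t B s err
  w-brk  : ∀ {s s'} → t s → B s (brk s') → W t B s (ok s')
  w-step : ∀ {s s' ŝ''} → t s → B s (ok s') → W t B s' ŝ'' → W t B s ŝ''

IsInvariant : {S : Set} → Pred S → Cmd S → Pred S → Pred S → Set
IsInvariant t B P I =
  (∀ s₀ → P s₀ → I s₀) ×
  (∀ s s' → I s → t s → B s (ok s') → I s')

IsSafeInvariant : {S : Set} → Pred S → Cmd S → Pred S → Pred S → Set
IsSafeInvariant t B P I =
  IsInvariant t B P I ×
  (∀ s → I s → t s → B s err → ⊥)

IsSummary : {S : Set} → Pred S → Cmd S → (S → S → Set) → Set
IsSummary t B R =
  (∀ sₙ → (t sₙ → ⊥) → R sₙ sₙ) ×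
  (∀ s sₙ → t s → B s (brk sₙ) → R s sₙ) ×
  (∀ s s' sₙ → t s → B s (ok s') → R s' sₙ → R s sₙ)

IsCorrectSummary : {S : Set} → Pred S → Cmd S → Pred S → Pred S → (S → S → Set) → Set
IsCorrectSummary t B P Q R =
  IsSummary t B R × (∀ s₀ sₙ → P s₀ → R s₀ sₙ → Q sₙ)

module Submission where

open import Defs
open import Data.Product using (Σ; _,_)

-- The summary is the loop's own input/output relation on normal outcomes.

loopSummary : {S : Set} → Pred S → Cmd S → S → S → Set
loopSummary t B s sₙ = W t B s (ok sₙ)

loopSummary-isSummary : {S : Set} (t : Pred S) (B : Cmd S) →
  IsSummary t B (loopSummary t B)
loopSummary-isSummary t B =
  (λ _ ¬t → w-exit ¬t) ,
  (λ _ _ ts b → w-brk ts b) ,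
  (λ _ _ _ ts b r → w-step ts b r)

loopSummary-correct : {S : Set} (t : Pred S) (B : Cmd S) (P Q : Pred S) →
  Valid P (W t B) Q →
  ∀ s₀ sₙ → P s₀ → loopSummary t B s₀ sₙ → Q sₙ
loopSummary-correct t B P Q valid s₀ sₙ = valid s₀ (ok sₙ)

theorem4 : {S : Set} (t : Pred S) (B : Cmd S) (P Q I : Pred S) →
    Valid P (W t B) Q →
    IsSafeInvariant t B P I →
    Σ (S → S → Set) (λ R → IsCorrectSummary t B P Q R)
theorem4 t B P Q I valid _ =
  loopSummary t B ,
  loopSummary-isSummary t B ,
  loopSummary-correct t B P Q valid
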